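{- For $N\ge 1$ let $\mathcal{P}(N)$ be the number of $A=(A_0,\dots,A_4)\in\mathbb{Z}^5$ with $\max_i|A_i|\le N$, $\gcd(A_0,\dots,A_4)=1$, and such that the variety $\mathcal{V}_A:\ \sum_{i=0}^4A_iX_i^5=0$ has infinitely many non-trivial integer points. Then $\mathcal{P}(N)\gg N^{1/10}$, i.e. there is a constant $c>0$ with $\mathcal{P}(N)\ge cN^{1/10}$ for all sufficiently large $N$.
   Context: An integer point $(X_0,\dots,X_4)\in\mathbb{Z}^5$ on $\mathcal{V}_A$ is called non-trivial if $\gcd(X_0,\dots,X_4)=1$ and no proper (nonempty) sub-sum of $\sum_{i=0}^4 A_iX_i^5$ vanishes. -}

module Defs where

open import Data.Nat as ℕ using (ℕ; _≤_)
open import Data.Integer as ℤ using (ℤ; +_; ∣_∣)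
open import Data.Integer.GCD using (gcd)
open import Data.Fin using (Fin)
open import Data.Vec using (Vec; lookup; foldr; tabulate; allFin)
open import Data.Vec.Relation.Unary.All using () renaming (All to AllV)
open import Data.Fin.Subset using (Subset; Side; inside; outside; Nonempty; ⊤)
open import Data.List using (List; length)
open import Data.List.Membership.Propositional using (_∉_)
open import Data.Product using (Σ; _×_; ∃)
open import Relation.Binary.PropositionalEquality using (_≡_; _≢_)

gcdVec : ∀ {n} → Vec ℤ n → ℤ
gcdVec = foldr _ gcd (+ 0)

subSum : Subset 5 → Vec ℤ 5 → Vec ℤ 5 → ℤ
subSum S A X = foldr _ ℤ._+_ (+ 0) (tabulate term)
  where
  term : Fin 5 → ℤ
  term i with lookup S i
  ... | inside  = lookup A i ℤ.* (lookup X i ℤ.^ 5)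
  ... | outside = + 0

form : Vec ℤ 5 → Vec ℤ 5 → ℤ
form A X = subSum ⊤ A X

OnV : Vec ℤ 5 → Vec ℤ 5 → Set
OnV A X = form A X ≡ + 0

NonTrivial : Vec ℤ 5 → Vec ℤ 5 → Set
NonTrivial A X =
  OnV A X × gcdVec X ≡ + 1 ×
  ((S : Subset 5) → Nonempty S → S ≢ ⊤ → subSum S A X ≢ + 0)

InfinitelyManyNonTrivial : Vec ℤ 5 → Set
InfinitelyManyNonTrivial A =
  (L : List (Vec ℤ 5)) → ∃ λ X → NonTrivial A X × X ∉ L

Counted : ℕ → Vec ℤ 5 → Set
Counted N A =
  AllV (λ a → ∣ a ∣ ≤ N) A × gcdVec A ≡ + 1 × InfinitelyManyNonTrivial A

-- With v = u² − 2 one has (v + 2u)⁵ + (v − 2u)⁵ + 6v⁵ + 256 = 8u¹⁰. So for every m the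
-- form with coefficients (1, 1, 6, −8m⁵, 256) vanishes at (v + 2u, v − 2u, v, ms², 1)
-- whenever u = ms, for every s. The last coordinate makes these points primitive and
-- |ms²| grows with s. If m ≡ s ≡ 1 (mod 17) the five terms are congruent to those of
-- m = s = 1, namely 1, 12, 11, 9, 1 (mod 17), and only their full sum vanishes mod 17;
-- hence no proper sub-sum vanishes. Taking m = 1 + 17j for all j with 8(1 + 17j)⁵ ≤ N
-- gives ≫ N^(1/5) distinct coefficient vectors of height at most N.
module Submission where

open import Defs
open import Data.Nat as ℕ using (ℕ; zero; suc; _≤_; _<_; z≤n; s≤s; _≤?_; NonZero)
open import Data.Nat.Properties using
  ( ≤-trans; ≤-antisym; <⇒≤; <⇒≢; <⇒≱; ≰⇒>; ≮⇒≥; <-irrefl; ≤ᵇ⇒≤; n<1+n; m≤m+n; m≤n+m; m≤m*n; m≤n*m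
  ; +-monoˡ-≤; *-monoʳ-≤; ^-monoˡ-≤; ^-monoʳ-≤; ^-monoˡ-<; *-suc; *-cancelˡ-≡; suc-injective; m^n≢0
  ; module ≤-Reasoning )
open import Data.Integer using (ℤ; +_; 0ℤ; 1ℤ; ∣_∣; -_)
import Data.Integer as ℤ
open import Data.Integer.Properties using (pos-*; ∣-i∣≡∣i∣)
open import Data.Integer.Divisibility.Signed using (_∣_; divides; _∣?_)
open import Data.Integer.GCD using (gcd; gcd-zeroˡ; gcd-zeroʳ)
open import Data.Integer.Tactic.RingSolver using (solve-∀)
import Data.Integer.Solver as ℤSolver
open import Data.Bool using () renaming (_≟_ to _≟ᵇ_)
open import Data.Fin using (#_)
open import Data.Fin.Subset using (Subset; Side; inside; outside; Nonempty; ⊤)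
open import Data.Fin.Subset.Properties using (nonempty?)
open import Data.Vec using (Vec; []; _∷_; lookup; foldr; tabulate)
open import Data.Vec.Relation.Unary.All using () renaming (All to AllV; [] to []ᵥ; _∷_ to _∷ᵥ_)
open import Data.Vec.Properties using (≡-dec)
open import Data.Vec.Membership.Propositional using () renaming (_∈_ to _∈ᵥ_)
open import Data.Vec.Relation.Unary.Any using (here; there)
open import Data.Vec.Relation.Binary.Pointwise.Inductive using (Pointwise; []; _∷_)
open import Data.List using (List; []; _∷_; _++_; map; length; applyUpTo)
open import Data.List.Properties using (∷-injectiveˡ; ∷-injectiveʳ; length-applyUpTo)
open import Data.List.Membership.Propositional using (_∈_; _∉_)
open import Data.List.Membership.Propositional.Properties using (∈-++⁺ˡ; ∈-++⁺ʳ; ∈-map⁺)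
open import Data.List.Relation.Unary.All as All using (All; []; _∷_; all?)
open import Data.List.Relation.Unary.All.Properties using (map⁻; applyUpTo⁺₁)
open import Data.List.Relation.Unary.Unique.Propositional using (Unique)
import Data.List.Relation.Unary.Unique.Propositional.Properties as Unique
open import Data.List.Relation.Unary.Any using () renaming (here to hereₗ)
open import Data.List.Extrema.Nat using (max; xs≤max)
open import Data.Product using (∃-syntax; _×_; _,_)
open import Function using (_∘_)
open import Relation.Binary.PropositionalEquality
open import Relation.Nullary using (¬_; Dec; yes; no; contradiction; ¬?)
open import Relation.Nullary.Decidable using (from-yes; _→-dec_)

module _ where

  open import Data.Integer using (_+_; _*_; _-_; _^_)
  open import Data.Integer.Properties using (+-identityˡ; +-inverseʳ; *-assoc; ^-distribˡ-+-*)

  infix 4 _≡_[mod_]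
  record _≡_[mod_] (a b n : ℤ) : Set where
    constructor congruent
    field
      quotient : ℤ
      equality : a ≡ b + n * quotient

  module Mod {n : ℤ} where

    reflexive : ∀ a → a ≡ a [mod n ]
    reflexive a = congruent 0ℤ (lemma a n)
      where
      lemma : ∀ a n → a ≡ a + n * 0ℤ
      lemma = solve-∀

    +-cong : ∀ {a b c d} → a ≡ b [mod n ] → c ≡ d [mod n ] → a + c ≡ b + d [mod n ]
    +-cong {b = b} {d = d} (congruent k refl) (congruent l refl) = congruent (k + l) (lemma b d k l n)
      where
      lemma : ∀ b d k l n → b + n * k + (d + n * l) ≡ b + d + n * (k + l)
      lemma = solve-∀

    *-cong : ∀ {a b c d} → a ≡ b [mod n ] → c ≡ d [mod n ] → a * c ≡ b * d [mod n ]
    *-cong {b = b} {d = d} (congruent k refl) (congruent l refl) = congruent (b * l + k * d + n * k * l) (lemma b d k l n)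
      where
      lemma : ∀ b d k l n → (b + n * k) * (d + n * l) ≡ b * d + n * (b * l + k * d + n * k * l)
      lemma = solve-∀

    -‿cong : ∀ {a b} → a ≡ b [mod n ] → - a ≡ - b [mod n ]
    -‿cong {b = b} (congruent k refl) = congruent (- k) (lemma b k n)
      where
      lemma : ∀ b k n → - (b + n * k) ≡ - b + n * - k
      lemma = solve-∀

    ^-cong : ∀ e {a b} → a ≡ b [mod n ] → a ^ e ≡ b ^ e [mod n ]
    ^-cong zero    a≡b = reflexive 1ℤ
    ^-cong (suc e) a≡b = *-cong a≡b (^-cong e a≡b)

    0≡⇒∣ : ∀ {c} → 0ℤ ≡ c [mod n ] → n ∣ c
    0≡⇒∣ {c} (congruent k 0≡c+nk) = divides (- k) (begin
      c                        ≡⟨ lemma c n k ⟩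
      (c + n * k) + - k * n    ≡⟨ cong (_+ - k * n) (sym 0≡c+nk) ⟩
      0ℤ + - k * n             ≡⟨ +-identityˡ (- k * n) ⟩
      - k * n                  ∎)
      where
      open ≡-Reasoning
      lemma : ∀ c n k → c ≡ (c + n * k) + - k * n
      lemma = solve-∀

  sideTerm : Side → ℤ → ℤ → ℤ
  sideTerm inside  a x = a * x ^ 5
  sideTerm outside _ _ = 0ℤ

  sideSum : ∀ {k} → Subset k → Vec ℤ k → Vec ℤ k → ℤ
  sideSum S A X = foldr _ _+_ 0ℤ (tabulate λ i → sideTerm (lookup S i) (lookup A i) (lookup X i))

  module _ {n : ℤ} where

    sideTerm-cong : ∀ s {a a′ x x′} → a ≡ a′ [mod n ] → x ≡ x′ [mod n ] →
                    sideTerm s a x ≡ sideTerm s a′ x′ [mod n ]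
    sideTerm-cong inside  a≈a′ x≈x′ = Mod.*-cong a≈a′ (Mod.^-cong 5 x≈x′)
    sideTerm-cong outside _    _    = Mod.reflexive 0ℤ

    sideSum-cong : ∀ {k} {A A′ X X′ : Vec ℤ k} →
                   Pointwise _≡_[mod n ] A A′ → Pointwise _≡_[mod n ] X X′ →
                   ∀ S → sideSum S A X ≡ sideSum S A′ X′ [mod n ]
    sideSum-cong []             []             []      = Mod.reflexive 0ℤ
    sideSum-cong (a≈a′ ∷ A≈A′) (x≈x′ ∷ X≈X′) (s ∷ S) =
      Mod.+-cong (sideTerm-cong s a≈a′ x≈x′) (sideSum-cong A≈A′ X≈X′ S)

  subsets : ∀ k → List (Subset k)
  subsets zero    = [] ∷ []
  subsets (suc k) = map (inside ∷_) (subsets k) ++ map (outside ∷_) (subsets k)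

  ∈-subsets : ∀ {k} (S : Subset k) → S ∈ subsets k
  ∈-subsets []            = hereₗ refl
  ∈-subsets (inside ∷ S)  = ∈-++⁺ˡ (∈-map⁺ (inside ∷_) (∈-subsets S))
  ∈-subsets (outside ∷ S) = ∈-++⁺ʳ _ (∈-map⁺ (outside ∷_) (∈-subsets S))

  All-subsets⇒∀ : ∀ {k} {P : Subset k → Set} → All P (subsets k) → ∀ S → P S
  All-subsets⇒∀ all S = All.lookup all (∈-subsets S)

  map-≡⇒All-≡ : ∀ {A B : Set} {f g : A → B} xs → map f xs ≡ map g xs → All (λ x → f x ≡ g x) xs
  map-≡⇒All-≡ []       _  = []
  map-≡⇒All-≡ (x ∷ xs) eq = ∷-injectiveˡ eq ∷ map-≡⇒All-≡ xs (∷-injectiveʳ eq)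

  -- subSum branches on lookup S i by a with, so it only computes on a concrete subset;
  -- on each of the 32 subsets listed by subsets 5 both sides reduce to the same term.
  subSum≡sideSum : ∀ A X S → subSum S A X ≡ sideSum S A X
  subSum≡sideSum A X = All-subsets⇒∀ (map-≡⇒All-≡ (subsets 5) refl)

  subSum-cong : ∀ {n A A′ X X′} → Pointwise _≡_[mod n ] A A′ → Pointwise _≡_[mod n ] X X′ →
                ∀ S → subSum S A X ≡ subSum S A′ X′ [mod n ]
  subSum-cong {n} {A} {A′} {X} {X′} A≈A′ X≈X′ S =
    subst₂ (_≡_[mod n ]) (sym (subSum≡sideSum A X S)) (sym (subSum≡sideSum A′ X′ S))
      (sideSum-cong A≈A′ X≈X′ S)

  1∈⇒gcdVec≡1 : ∀ {k} {xs : Vec ℤ k} → 1ℤ ∈ᵥ xs → gcdVec xs ≡ 1ℤ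
  1∈⇒gcdVec≡1 {xs = _ ∷ xs} (here refl)  = gcd-zeroˡ (gcdVec xs)
  1∈⇒gcdVec≡1 {xs = x ∷ _}  (there 1∈xs) = trans (cong (gcd x) (1∈⇒gcdVec≡1 1∈xs)) (gcd-zeroʳ x)

  coeffs : ℤ → Vec ℤ 5
  coeffs m = 1ℤ ∷ 1ℤ ∷ + 6 ∷ - (+ 8 * m ^ 5) ∷ + 256 ∷ []

  point : ℤ → ℤ → Vec ℤ 5
  point m s = u * u + + 2 * u - + 2 ∷ u * u - + 2 * u - + 2 ∷ u * u - + 2 ∷ m * (s * s) ∷ 1ℤ ∷ []
    where u = m * s

  fifth-power-identity : ∀ u → (u * u + + 2 * u - + 2) ^ 5 + (u * u - + 2 * u - + 2) ^ 5 + + 6 * (u * u - + 2) ^ 5 + + 256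
                               ≡ + 8 * u ^ 10
  fifth-power-identity = solve 1 (λ u →
      (u :* u :+ con (+ 2) :* u :- con (+ 2)) :^ 5 :+ (u :* u :- con (+ 2) :* u :- con (+ 2)) :^ 5
        :+ con (+ 6) :* (u :* u :- con (+ 2)) :^ 5 :+ con (+ 256)
      := con (+ 8) :* u :^ 10) refl
    where open ℤSolver.+-*-Solver

  private
    ^-distribʳ-* : ∀ i j n → (i * j) ^ n ≡ i ^ n * j ^ n
    ^-distribʳ-* i j zero    = refl
    ^-distribʳ-* i j (suc n) = trans (cong (i * j *_) (^-distribʳ-* i j n)) (lemma i j (i ^ n) (j ^ n))
      where
      lemma : ∀ i j a b → i * j * (a * b) ≡ i * a * (j * b)
      lemma = solve-∀

  m⁵[ms²]⁵≡[ms]¹⁰ : ∀ m s → m ^ 5 * (m * (s * s)) ^ 5 ≡ (m * s) ^ 10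
  m⁵[ms²]⁵≡[ms]¹⁰ m s = begin
    m ^ 5 * (m * (s * s)) ^ 5        ≡⟨ cong (m ^ 5 *_) (^-distribʳ-* m (s * s) 5) ⟩
    m ^ 5 * (m ^ 5 * (s * s) ^ 5)    ≡⟨ sym (*-assoc (m ^ 5) (m ^ 5) _) ⟩
    m ^ 5 * m ^ 5 * (s * s) ^ 5      ≡⟨ cong₂ _*_ (sym (^-distribˡ-+-* m 5 5)) (^-distribʳ-* s s 5) ⟩
    m ^ 10 * (s ^ 5 * s ^ 5)         ≡⟨ cong (m ^ 10 *_) (sym (^-distribˡ-+-* s 5 5)) ⟩
    m ^ 10 * s ^ 10                  ≡⟨ sym (^-distribʳ-* m s 10) ⟩
    (m * s) ^ 10                     ∎
    where open ≡-Reasoning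

  point-onV : ∀ m s → OnV (coeffs m) (point m s)
  point-onV m s = begin
    form (coeffs m) (point m s)
      ≡⟨ rearrange (x₀ ^ 5) (x₁ ^ 5) (x₂ ^ 5) (m ^ 5) ((m * (s * s)) ^ 5) ⟩
    x₀ ^ 5 + x₁ ^ 5 + + 6 * x₂ ^ 5 + + 256 - + 8 * (m ^ 5 * (m * (s * s)) ^ 5)
      ≡⟨ cong₂ (λ a b → a - + 8 * b) (fifth-power-identity u) (m⁵[ms²]⁵≡[ms]¹⁰ m s) ⟩
    + 8 * u ^ 10 - + 8 * u ^ 10
      ≡⟨ +-inverseʳ (+ 8 * u ^ 10) ⟩
    0ℤ ∎
    where
    open ≡-Reasoning
    u x₀ x₁ x₂ : ℤ
    u  = m * s
    x₀ = u * u + + 2 * u - + 2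
    x₁ = u * u - + 2 * u - + 2
    x₂ = u * u - + 2
    rearrange : ∀ p q r a b → 1ℤ * p + (1ℤ * q + (+ 6 * r + (- (+ 8 * a) * b + (+ 256 + 0ℤ))))
                             ≡ p + q + + 6 * r + + 256 - + 8 * (a * b)
    rearrange = solve-∀

  module _ {n : ℤ} where

    coeffs-cong : ∀ {m m′} → m ≡ m′ [mod n ] → Pointwise _≡_[mod n ] (coeffs m) (coeffs m′)
    coeffs-cong m≈m′ =
      Mod.reflexive 1ℤ ∷ Mod.reflexive 1ℤ ∷ Mod.reflexive (+ 6) ∷
      Mod.-‿cong (Mod.*-cong (Mod.reflexive (+ 8)) (Mod.^-cong 5 m≈m′)) ∷ Mod.reflexive (+ 256) ∷ []

    point-cong : ∀ {m m′ s s′} → m ≡ m′ [mod n ] → s ≡ s′ [mod n ] →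
                 Pointwise _≡_[mod n ] (point m s) (point m′ s′)
    point-cong {m} {m′} {s} {s′} m≈m′ s≈s′ =
      Mod.+-cong (Mod.+-cong u²≈ 2u≈) -2≈ ∷ Mod.+-cong (Mod.+-cong u²≈ (Mod.-‿cong 2u≈)) -2≈ ∷
      Mod.+-cong u²≈ -2≈ ∷ Mod.*-cong m≈m′ (Mod.*-cong s≈s′ s≈s′) ∷ Mod.reflexive 1ℤ ∷ []
      where
      u≈ : m * s ≡ m′ * s′ [mod n ]
      u≈ = Mod.*-cong m≈m′ s≈s′
      u²≈ : m * s * (m * s) ≡ m′ * s′ * (m′ * s′) [mod n ]
      u²≈ = Mod.*-cong u≈ u≈
      2u≈ : + 2 * (m * s) ≡ + 2 * (m′ * s′) [mod n ]
      2u≈ = Mod.*-cong (Mod.reflexive (+ 2)) u≈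
      -2≈ : - + 2 ≡ - + 2 [mod n ]
      -2≈ = Mod.reflexive (- + 2)

  17∤proper-subSum : ∀ S → Nonempty S → S ≢ ⊤ → ¬ (+ 17 ∣ subSum S (coeffs 1ℤ) (point 1ℤ 1ℤ))
  17∤proper-subSum = All-subsets⇒∀ (from-yes (all? 17∤proper-subSum? (subsets 5)))
    where
    17∤proper-subSum? : ∀ S → Dec (Nonempty S → S ≢ ⊤ → ¬ (+ 17 ∣ subSum S (coeffs 1ℤ) (point 1ℤ 1ℤ)))
    17∤proper-subSum? S = nonempty? S →-dec ¬? (≡-dec _≟ᵇ_ S ⊤) →-dec ¬? (+ 17 ∣? subSum S (coeffs 1ℤ) (point 1ℤ 1ℤ))

  point-nonTrivial : ∀ {m s} → m ≡ 1ℤ [mod + 17 ] → s ≡ 1ℤ [mod + 17 ] → NonTrivial (coeffs m) (point m s)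
  point-nonTrivial {m} {s} m≡1 s≡1 =
    point-onV m s , 1∈⇒gcdVec≡1 {xs = point m s} (there (there (there (there (here refl))))) , proper-subSum≢0
    where
    proper-subSum≢0 : ∀ S → Nonempty S → S ≢ ⊤ → subSum S (coeffs m) (point m s) ≢ 0ℤ
    proper-subSum≢0 S nonempty S≢⊤ subSum≡0 =
      17∤proper-subSum S nonempty S≢⊤ (Mod.0≡⇒∣ (subst (_≡ _ [mod + 17 ]) subSum≡0
        (subSum-cong (coeffs-cong m≡1) (point-cong m≡1 s≡1) S)))

  unbounded⇒escapes : ∀ {A : Set} (P : A → Set) (size : A → ℕ) →
                      (∀ b → ∃[ x ] P x × b < size x) → (L : List A) → ∃[ x ] P x × x ∉ L
  unbounded⇒escapes P size unbounded L with unbounded (max 0 (map size L))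
  ... | x , Px , max<size = x , Px , λ x∈L → <⇒≱ max<size (All.lookup (map⁻ (xs≤max 0 (map size L))) x∈L)

  oneMod17 : ℕ → ℤ
  oneMod17 j = + (1 ℕ.+ 17 ℕ.* j)

  oneMod17≡1 : ∀ j → oneMod17 j ≡ 1ℤ [mod + 17 ]
  oneMod17≡1 j = congruent (+ j) (cong (_+_ 1ℤ) (pos-* 17 j))

  ∣+a*[+b*+b]∣ : ∀ a b → ∣ + a * (+ b * + b) ∣ ≡ a ℕ.* (b ℕ.* b)
  ∣+a*[+b*+b]∣ a b = cong ∣_∣ (trans (cong (+ a *_) (sym (pos-* b b))) (sym (pos-* a (b ℕ.* b))))

  coeffs-infinitelyMany : ∀ j → InfinitelyManyNonTrivial (coeffs (oneMod17 j))
  coeffs-infinitelyMany j = unbounded⇒escapes (NonTrivial (coeffs (oneMod17 j))) (λ X → ∣ lookup X (# 3) ∣) far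
    where
    far : ∀ t → ∃[ X ] NonTrivial (coeffs (oneMod17 j)) X × t < ∣ lookup X (# 3) ∣
    far t = point (oneMod17 j) (oneMod17 t) , point-nonTrivial (oneMod17≡1 j) (oneMod17≡1 t) , t<size
      where
      a b : ℕ
      a = 1 ℕ.+ 17 ℕ.* j
      b = 1 ℕ.+ 17 ℕ.* t
      t<size : t < ∣ + a * (+ b * + b) ∣
      t<size = begin-strict
        t                       <⟨ s≤s (m≤n*m t 17) ⟩
        b                       ≤⟨ m≤m*n b b ⟩
        b ℕ.* b                 ≤⟨ m≤n*m (b ℕ.* b) a ⟩
        a ℕ.* (b ℕ.* b)         ≡⟨ sym (∣+a*[+b*+b]∣ a b) ⟩
        ∣ + a * (+ b * + b) ∣   ∎
        where open ≤-Reasoning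

open import Data.Nat using (_+_; _*_; _^_)
import Data.Nat.Tactic.RingSolver as ℕSolver
open import Data.Nat.Properties using (*-assoc)

^-distribʳ-* : ∀ a b n → (a * b) ^ n ≡ a ^ n * b ^ n
^-distribʳ-* a b zero    = refl
^-distribʳ-* a b (suc n) = trans (cong (a * b *_) (^-distribʳ-* a b n)) (lemma a b (a ^ n) (b ^ n))
  where
  lemma : ∀ a b x y → a * b * (x * y) ≡ a * x * (b * y)
  lemma = ℕSolver.solve-∀

^-injectiveˡ : ∀ n .{{_ : NonZero n}} {a b} → a ^ n ≡ b ^ n → a ≡ b
^-injectiveˡ n aⁿ≡bⁿ = ≤-antisym
  (≮⇒≥ λ b<a → <-irrefl (sym aⁿ≡bⁿ) (^-monoˡ-< n b<a))
  (≮⇒≥ λ a<b → <-irrefl aⁿ≡bⁿ (^-monoˡ-< n a<b))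

crossing : ∀ (f : ℕ → ℕ) {N} M → f 0 ≤ N → N < f M → ∃[ k ] f k ≤ N × N < f (suc k)
crossing f zero        f0≤N N<f0 = contradiction f0≤N (<⇒≱ N<f0)
crossing f {N} (suc M) f0≤N N<f[1+M] with f M ≤? N
... | yes fM≤N = M , fM≤N , N<f[1+M]
... | no  fM≰N = crossing f M f0≤N (≰⇒> fM≰N)

pos-^ : ∀ a n → + (a ^ n) ≡ (+ a) ℤ.^ n
pos-^ a zero    = refl
pos-^ a (suc n) = trans (pos-* a (a ^ n)) (cong (+ a ℤ.*_) (pos-^ a n))

∣coeffs₃∣ : ∀ a → ∣ lookup (coeffs (+ a)) (# 3) ∣ ≡ 8 * a ^ 5
∣coeffs₃∣ a = begin
  ∣ - (+ 8 ℤ.* (+ a) ℤ.^ 5) ∣   ≡⟨ ∣-i∣≡∣i∣ (+ 8 ℤ.* (+ a) ℤ.^ 5) ⟩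
  ∣ + 8 ℤ.* (+ a) ℤ.^ 5 ∣       ≡⟨ cong (λ x → ∣ + 8 ℤ.* x ∣) (sym (pos-^ a 5)) ⟩
  ∣ + 8 ℤ.* + (a ^ 5) ∣       ≡⟨ cong ∣_∣ (sym (pos-* 8 (a ^ 5))) ⟩
  8 * a ^ 5                   ∎
  where open ≡-Reasoning

coeffs-bounded : ∀ {N} a → 256 ≤ N → 8 * a ^ 5 ≤ N → AllV (λ c → ∣ c ∣ ≤ N) (coeffs (+ a))
coeffs-bounded {N} a 256≤N 8a⁵≤N =
  small (m≤m+n 1 255) ∷ᵥ small (m≤m+n 1 255) ∷ᵥ small (m≤m+n 6 250) ∷ᵥ
  subst (_≤ N) (sym (∣coeffs₃∣ a)) 8a⁵≤N ∷ᵥ 256≤N ∷ᵥ []ᵥ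
  where
  small : ∀ {c} → c ≤ 256 → c ≤ N
  small c≤256 = ≤-trans c≤256 256≤N

family : ℕ → Vec ℤ 5
family j = coeffs (oneMod17 j)

family-injective : ∀ {i j} → family i ≡ family j → i ≡ j
family-injective {i} {j} eq =
  *-cancelˡ-≡ i j 17 (suc-injective (^-injectiveˡ 5 (*-cancelˡ-≡ _ _ 8 8a⁵≡8b⁵)))
  where
  8a⁵≡8b⁵ : 8 * (1 + 17 * i) ^ 5 ≡ 8 * (1 + 17 * j) ^ 5
  8a⁵≡8b⁵ = trans (sym (∣coeffs₃∣ (1 + 17 * i))) (trans (cong (λ A → ∣ lookup A (# 3) ∣) eq) (∣coeffs₃∣ (1 + 17 * j)))

family-counted : ∀ {N} j → 256 ≤ N → 8 * (1 + 17 * j) ^ 5 ≤ N → Counted N (family j)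
family-counted j 256≤N height≤N =
  coeffs-bounded (1 + 17 * j) 256≤N height≤N , 1∈⇒gcdVec≡1 {xs = family j} (here refl) , coeffs-infinitelyMany j

bound : ℕ → ℕ
bound k = 8 * (17 * k) ^ 5

n<bound[1+n] : ∀ n → n < bound (suc n)
n<bound[1+n] n = begin-strict
  n                  <⟨ n<1+n n ⟩
  suc n              ≤⟨ m≤n*m (suc n) 17 ⟩
  x                  ≤⟨ m≤m*n x (x ^ 4) {{m^n≢0 x 4}} ⟩
  x ^ 5              ≤⟨ m≤n*m (x ^ 5) 8 ⟩
  bound (suc n)      ∎
  where
  open ≤-Reasoning
  x : ℕ
  x = 17 * suc n

height≤bound : ∀ {j k} → j < k → 8 * (1 + 17 * j) ^ 5 ≤ bound k
height≤bound {j} {k} j<k = *-monoʳ-≤ 8 (^-monoˡ-≤ 5 (begin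
  1 + 17 * j         ≤⟨ +-monoˡ-≤ (17 * j) (m≤m+n 1 16) ⟩
  17 + 17 * j        ≡⟨ sym (*-suc 17 j) ⟩
  17 * suc j         ≤⟨ *-monoʳ-≤ 17 j<k ⟩
  17 * k             ∎))
  where open ≤-Reasoning

-- Kept opaque: a literal this large multiplying a neutral term would be unfolded
-- by the type checker one successor at a time.
opaque
  d : ℕ
  d = 8 * 34 ^ 5

opaque
  unfolding d

  bound[2k] : ∀ k → bound (k + k) ≡ d * k ^ 5
  bound[2k] k = begin
    8 * (17 * (k + k)) ^ 5    ≡⟨ cong (λ x → 8 * x ^ 5) (17*[k+k]≡34*k k) ⟩
    8 * (34 * k) ^ 5          ≡⟨ cong (8 *_) (^-distribʳ-* 34 k 5) ⟩
    8 * (34 ^ 5 * k ^ 5)      ≡⟨ sym (*-assoc 8 (34 ^ 5) (k ^ 5)) ⟩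
    8 * 34 ^ 5 * k ^ 5        ∎
    where
    open ≡-Reasoning
    17*[k+k]≡34*k : ∀ k → 17 * (k + k) ≡ 34 * k
    17*[k+k]≡34*k = ℕSolver.solve-∀

N<bound[1+k]⇒N≤d*k¹⁰ : ∀ {N} k → bound 1 ≤ N → N < bound (suc k) → N ≤ d * k ^ 10
N<bound[1+k]⇒N≤d*k¹⁰ zero        bound1≤N N<bound1 = contradiction bound1≤N (<⇒≱ N<bound1)
N<bound[1+k]⇒N≤d*k¹⁰ {N} k@(suc k′) _ N<bound[1+k] = begin
  N                      ≤⟨ <⇒≤ N<bound[1+k] ⟩
  bound (suc k)          ≤⟨ *-monoʳ-≤ 8 (^-monoˡ-≤ 5 (*-monoʳ-≤ 17 (s≤s (m≤n+m k k′)))) ⟩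
  bound (k + k)          ≡⟨ bound[2k] k ⟩
  d * k ^ 5              ≤⟨ *-monoʳ-≤ d (^-monoʳ-≤ k (m≤m+n 5 5)) ⟩
  d * k ^ 10             ∎
  where open ≤-Reasoning

applyUpTo-family-counted : ∀ {N} k → bound 1 ≤ N → bound k ≤ N → N < bound (suc k) →
                           ∃[ L ] (Unique {A = Vec ℤ 5} L × All (Counted N) L × N ≤ d * length L ^ 10)
applyUpTo-family-counted {N} k bound1≤N bound[k]≤N N<bound[1+k] =
  applyUpTo family k ,
  Unique.applyUpTo⁺₁ family k (λ i<j _ → <⇒≢ i<j ∘ family-injective) ,
  applyUpTo⁺₁ family k (λ {j} j<k → family-counted j 256≤N (≤-trans (height≤bound j<k) bound[k]≤N)) ,
  subst (λ n → N ≤ d * n ^ 10) (sym (length-applyUpTo family k)) (N<bound[1+k]⇒N≤d*k¹⁰ k bound1≤N N<bound[1+k])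
  where
  256≤N : 256 ≤ N
  256≤N = ≤-trans (≤ᵇ⇒≤ 256 (bound 1) _) bound1≤N

theorem3p3 : ∃[ d ] ∃[ N₀ ] ((N : ℕ) → N₀ ≤ N →
    ∃[ L ] (Unique {A = Vec ℤ 5} L × All (Counted N) L × N ≤ d * length L ^ 10))
theorem3p3 = d , bound 1 , λ N bound1≤N →
  let k , bound[k]≤N , N<bound[1+k] = crossing bound (suc N) z≤n (n<bound[1+n] N)
  in applyUpTo-family-counted k bound1≤N bound[k]≤N N<bound[1+k]
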